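{- For $n\geq 3$ and any finite simple connected graph $G$ with $|V(G)|\geq 3$, $\gamma_{P,c}(G\,\square\,F_n)\leq 2\gamma_c(G)$.
   Context: Power domination: for $S\subseteq V(G)$, start with $M(S)=N[S]$ and repeatedly add a vertex $w$ whenever some $v\in M(S)$ has $w$ as its unique neighbour outside $M(S)$; $S$ is a connected power dominating set if the final $M(S)$ is the whole vertex set and $\langle S\rangle$ is connected; $\gamma_{P,c}$ denotes the minimum size of such a set. $\gamma_c(G)$ is the connected domination number. The Cartesian product $G\,\square\,H$ has vertex set $V(G)\times V(H)$, with $(a,b)\sim(x,y)$ iff either $a=x$ and $by\in E(H)$, or $b=y$ and $ax\in E(G)$. $F_n$ denotes the fan graph (a path together with one additional vertex adjacent to all path vertices). -}

module Defs where

open import Data.Nat using (ℕ; zero; suc; _+_; _*_)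
open import Data.Nat.Base using (_≡ᵇ_)
open import Data.Bool using (Bool; true; false; _∧_; _∨_)
open import Data.Fin using (Fin; zero; suc; toℕ; remQuot)
open import Data.Fin.Subset using (Subset; _∈_; _∉_)
open import Data.Product using (Σ; ∃; _×_; _,_)
open import Data.Sum using (_⊎_)
open import Data.Unit using (⊤)
open import Relation.Binary.PropositionalEquality using (_≡_; _≢_)

record Graph (n : ℕ) : Set where
  constructor mkGraph
  field
    adj : Fin n → Fin n → Bool

open Graph public

record IsSimple {n : ℕ} (G : Graph n) : Set where
  field
    sym    : ∀ u v → adj G u v ≡ adj G v u
    irrefl : ∀ v → adj G v v ≡ false

data WalkIn {n : ℕ} (G : Graph n) (P : Fin n → Set) : Fin n → Fin n → Set where
  here : ∀ {u} → P u → WalkIn G P u u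
  step : ∀ {u v w} → P u → adj G u v ≡ true → WalkIn G P v w → WalkIn G P u w

Connected : {n : ℕ} → Graph n → Set
Connected G = ∀ u v → WalkIn G (λ _ → ⊤) u v

InducedConnected : {n : ℕ} → Graph n → Subset n → Set
InducedConnected G S = ∀ u v → u ∈ S → v ∈ S → WalkIn G (_∈ S) u v

Dominating : {n : ℕ} → Graph n → Subset n → Set
Dominating G D = ∀ v → v ∈ D ⊎ Σ _ (λ u → u ∈ D × adj G u v ≡ true)

ConnectedDominating : {n : ℕ} → Graph n → Subset n → Set
ConnectedDominating G D = Dominating G D × InducedConnected G D

-- Final observed set M(S) of the power domination process: the least set
-- containing N[S] and closed under the propagation rule
-- (v ∈ M, w the unique neighbour of v outside M  ⟹  w ∈ M).
data Observed {n : ℕ} (G : Graph n) (S : Subset n) : Fin n → Set where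
  self  : ∀ {v} → v ∈ S → Observed G S v
  nbr   : ∀ {u v} → u ∈ S → adj G u v ≡ true → Observed G S v
  force : ∀ {v w} → Observed G S v → adj G v w ≡ true →
          (∀ x → adj G v x ≡ true → x ≢ w → Observed G S x) →
          Observed G S w

PowerDominating : {n : ℕ} → Graph n → Subset n → Set
PowerDominating G S = ∀ v → Observed G S v

ConnectedPowerDominating : {n : ℕ} → Graph n → Subset n → Set
ConnectedPowerDominating G S = PowerDominating G S × InducedConnected G S

_==_ : {n : ℕ} → Fin n → Fin n → Bool
i == j = toℕ i ≡ᵇ toℕ j

-- Cartesian product on vertex set Fin (m * k), with (a , b) encoded as combine a b.
_□_ : {m k : ℕ} → Graph m → Graph k → Graph (m * k)
_□_ {m} {k} G H = mkGraph λ x y → go (remQuot k x) (remQuot k y)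
  where
  go : Fin m × Fin k → Fin m × Fin k → Bool
  go (a , b) (a' , b') = ((a == a') ∧ adj H b b') ∨ ((b == b') ∧ adj G a a')

-- Fan graph F_n = P_n + K_1 on Fin (suc n): vertex zero is the apex,
-- suc i (i : Fin n) are the path vertices, path i — i+1.
Fan : (n : ℕ) → Graph (suc n)
Fan n = mkGraph f
  where
  f : Fin (suc n) → Fin (suc n) → Bool
  f zero    zero    = false
  f zero    (suc j) = true
  f (suc i) zero    = true
  f (suc i) (suc j) = (suc (toℕ i) ≡ᵇ toℕ j) ∨ (suc (toℕ j) ≡ᵇ toℕ i)

{-# OPTIONS --safe #-}
-- Take a connected dominating set D of G and let S = D × {apex, first path vertex}.
-- S is connected and twice as large as D. It dominates the apex layer and the first
-- path layer; then each path layer forces the next one, because a path vertex (a, vᵢ)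
-- has only one neighbour outside the layers V(G) × {apex, v₁, …, vᵢ}, namely (a, vᵢ₊₁).
module Submission where

open import Defs
open import Data.Nat using (ℕ; suc; _*_; _≤_)
open import Data.Fin.Subset using (Subset; ∣_∣)
open import Data.Product using (Σ; _×_)

open import Data.Bool using (Bool; true; false; _∧_; _∨_; if_then_else_)
open import Data.Bool.Properties using (∨-zeroʳ; T-≡)
open import Data.Empty using (⊥-elim)
open import Function.Bundles using (Equivalence)
open import Data.Fin as Fin using (Fin; zero; suc; toℕ; combine; inject₁)
open import Data.Fin.Induction using (<-weakInduction)
open import Data.Fin.Properties using (toℕ-injective; toℕ-inject₁; remQuot-combine; combine-surjective)
open import Data.Fin.Subset using (_∈_; ⊥; inside; outside)
open import Data.Fin.Subset.Properties using (∉⊥; ∣⊥∣≡0)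
open import Data.Nat as ℕ using (zero; _+_; _≡ᵇ_; s≤s)
open import Data.Nat.Properties as ℕ using (*-comm; ≤-reflexive; ≤-refl; m≤n⇒m<n∨m≡n)
open import Data.Product using (_,_)
open import Data.Sum using (_⊎_; inj₁; inj₂)
open import Data.Vec as Vec using ([]; _∷_; _++_; concat; map; lookup)
open import Data.Vec.Properties using (lookup-concat; lookup-map; lookup-replicate; []=⇒lookup; lookup⇒[]=)
open import Relation.Binary.PropositionalEquality

private
  variable
    m k : ℕ

≡ᵇ-refl : ∀ x → (x ≡ᵇ x) ≡ true
≡ᵇ-refl x = Equivalence.to T-≡ (ℕ.≡⇒≡ᵇ x x refl)

≡ᵇ⇒≡ : ∀ x y → (x ≡ᵇ y) ≡ true → x ≡ y
≡ᵇ⇒≡ x y e = ℕ.≡ᵇ⇒≡ x y (Equivalence.from T-≡ e)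

==-refl : (i : Fin k) → (i == i) ≡ true
==-refl i = ≡ᵇ-refl (toℕ i)

==⇒≡ : (i j : Fin k) → (i == j) ≡ true → i ≡ j
==⇒≡ i j e = toℕ-injective (≡ᵇ⇒≡ (toℕ i) (toℕ j) e)

∧-true⁻ : ∀ x y → (x ∧ y) ≡ true → x ≡ true × y ≡ true
∧-true⁻ true true _ = refl , refl

∨-true⁻ : ∀ x y → (x ∨ y) ≡ true → x ≡ true ⊎ y ≡ true
∨-true⁻ true  _ _ = inj₁ refl
∨-true⁻ false _ e = inj₂ e

∀-combine : {P : Fin (m * k) → Set} → (∀ a b → P (combine a b)) → ∀ x → P x
∀-combine {m} {k} {P} f x = let a , b , ab≡x = combine-surjective {m} {k} x in subst P ab≡x (f a b)

module _ {n : ℕ} {G : Graph n} {P : Fin n → Set} where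

  WalkIn-++ : ∀ {u v w} → WalkIn G P u v → WalkIn G P v w → WalkIn G P u w
  WalkIn-++ (here _)      q = q
  WalkIn-++ (step p e w) q = step p e (WalkIn-++ w q)

  WalkIn-map : ∀ {n′} {G′ : Graph n′} {Q : Fin n′ → Set} (f : Fin n → Fin n′) →
               (∀ {u v} → adj G u v ≡ true → adj G′ (f u) (f v) ≡ true) →
               (∀ {u} → P u → Q (f u)) →
               ∀ {u v} → WalkIn G P u v → WalkIn G′ Q (f u) (f v)
  WalkIn-map f f-adj f-P (here p)     = here (f-P p)
  WalkIn-map f f-adj f-P (step p e w) = step (f-P p) (f-adj e) (WalkIn-map f f-adj f-P w)

module _ {G : Graph m} {H : Graph k} where

  □-adj : ∀ a b a′ b′ → adj (G □ H) (combine a b) (combine a′ b′) ≡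
          ((a == a′) ∧ adj H b b′) ∨ ((b == b′) ∧ adj G a a′)
  □-adj a b a′ b′ = cong₂ adj-pairs (remQuot-combine a b) (remQuot-combine a′ b′)
    where
    adj-pairs : Fin m × Fin k → Fin m × Fin k → Bool
    adj-pairs (a , b) (a′ , b′) = ((a == a′) ∧ adj H b b′) ∨ ((b == b′) ∧ adj G a a′)

  □-adj-fibre : ∀ a {b b′} → adj H b b′ ≡ true → adj (G □ H) (combine a b) (combine a b′) ≡ true
  □-adj-fibre a {b} {b′} e
    rewrite □-adj a b a b′ | ==-refl a | e = refl

  □-adj-layer : ∀ {a a′} b → adj G a a′ ≡ true → adj (G □ H) (combine a b) (combine a′ b) ≡ true
  □-adj-layer {a} {a′} b e
    rewrite □-adj a b a′ b | ==-refl b | e | ∨-zeroʳ ((a == a′) ∧ adj H b b) = refl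

  □-adj⁻ : ∀ a b a′ b′ → adj (G □ H) (combine a b) (combine a′ b′) ≡ true →
           (a ≡ a′ × adj H b b′ ≡ true) ⊎ (b ≡ b′ × adj G a a′ ≡ true)
  □-adj⁻ a b a′ b′ e with ∨-true⁻ _ _ (trans (sym (□-adj a b a′ b′)) e)
  ... | inj₁ fibre = let a≡a′ , e′ = ∧-true⁻ _ _ fibre in inj₁ (==⇒≡ a a′ a≡a′ , e′)
  ... | inj₂ layer = let b≡b′ , e′ = ∧-true⁻ _ _ layer in inj₂ (==⇒≡ b b′ b≡b′ , e′)

_⊠_ : Subset m → Subset k → Subset (m * k)
A ⊠ B = concat (map (λ x → if x then B else ⊥) A)

lookup-⊠ : (A : Subset m) (B : Subset k) (a : Fin m) (b : Fin k) →
           lookup (A ⊠ B) (combine a b) ≡ lookup A a ∧ lookup B b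
lookup-⊠ {k = k} A B a b = begin
  lookup (A ⊠ B) (combine a b)     ≡⟨ lookup-concat (map row A) a b ⟩
  lookup (lookup (map row A) a) b  ≡⟨ cong (λ r → lookup r b) (lookup-map a row A) ⟩
  lookup (row (lookup A a)) b      ≡⟨ lookup-row (lookup A a) ⟩
  lookup A a ∧ lookup B b          ∎
  where
  open ≡-Reasoning
  row : Bool → Subset k
  row x = if x then B else ⊥
  lookup-row : ∀ x → lookup (row x) b ≡ x ∧ lookup B b
  lookup-row true  = refl
  lookup-row false = lookup-replicate b outside

∈-⊠ : {A : Subset m} {B : Subset k} {a : Fin m} {b : Fin k} → a ∈ A → b ∈ B → combine a b ∈ A ⊠ B
∈-⊠ {A = A} {B} {a} {b} a∈A b∈B = lookup⇒[]= (combine a b) (A ⊠ B)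
  (trans (lookup-⊠ A B a b) (cong₂ _∧_ ([]=⇒lookup a∈A) ([]=⇒lookup b∈B)))

∈-⊠⁻ : {A : Subset m} {B : Subset k} {a : Fin m} {b : Fin k} → combine a b ∈ A ⊠ B → a ∈ A × b ∈ B
∈-⊠⁻ {A = A} {B} {a} {b} ab∈A⊠B =
  let a∈A , b∈B = ∧-true⁻ _ _ (trans (sym (lookup-⊠ A B a b)) ([]=⇒lookup ab∈A⊠B))
  in lookup⇒[]= a A a∈A , lookup⇒[]= b B b∈B

∣++∣ : ∀ {p q} (xs : Subset p) (ys : Subset q) → ∣ xs ++ ys ∣ ≡ ∣ xs ∣ + ∣ ys ∣
∣++∣ []            ys = refl
∣++∣ (true  ∷ xs) ys = cong suc (∣++∣ xs ys)
∣++∣ (false ∷ xs) ys = ∣++∣ xs ys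

∣⊠∣ : (A : Subset m) (B : Subset k) → ∣ A ⊠ B ∣ ≡ ∣ A ∣ * ∣ B ∣
∣⊠∣ []            B = refl
∣⊠∣ (true  ∷ A) B = trans (∣++∣ B (A ⊠ B)) (cong (∣ B ∣ +_) (∣⊠∣ A B))
∣⊠∣ {k = k} (false ∷ A) B = trans (∣++∣ (⊥ {k}) (A ⊠ B)) (cong₂ _+_ (∣⊥∣≡0 k) (∣⊠∣ A B))

⊠-inducedConnected : {G : Graph m} {H : Graph k} {A : Subset m} {B : Subset k} →
                     InducedConnected G A → InducedConnected H B →
                     InducedConnected (G □ H) (A ⊠ B)
⊠-inducedConnected {G = G} {H} A-conn B-conn =
  ∀-combine λ a b → ∀-combine λ c d ab∈S cd∈S →
  let a∈A , b∈B = ∈-⊠⁻ ab∈S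
      c∈A , d∈B = ∈-⊠⁻ cd∈S
  in WalkIn-++ (WalkIn-map (combine a) (□-adj-fibre {G = G} {H = H} a) (∈-⊠ a∈A)
                            (B-conn b d b∈B d∈B))
               (WalkIn-map (λ x → combine x d) (□-adj-layer {G = G} {H = H} d) (λ x∈A → ∈-⊠ x∈A d∈B)
                            (A-conn a c a∈A c∈A))

LayerObserved : (G : Graph m) (H : Graph k) → Subset (m * k) → Fin k → Set
LayerObserved {m} G H S b = (a : Fin m) → Observed (G □ H) S (combine a b)

⊠-observes-layer : {G : Graph m} {H : Graph k} {D : Subset m} {B : Subset k} {b : Fin k} →
                   Dominating G D → b ∈ B → LayerObserved G H (D ⊠ B) b
⊠-observes-layer {G = G} {H} {b = b} D-dom b∈B a with D-dom a
... | inj₁ a∈D           = self (∈-⊠ a∈D b∈B)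
... | inj₂ (u , u∈D , e) = nbr (∈-⊠ u∈D b∈B) (□-adj-layer {G = G} {H = H} b e)

layer-force : {G : Graph m} {H : Graph k} {S : Subset (m * k)} {b c : Fin k} →
              adj H b c ≡ true → LayerObserved G H S b →
              (∀ b′ → adj H b b′ ≡ true → b′ ≢ c → LayerObserved G H S b′) →
              LayerObserved G H S c
layer-force {m} {k} {G} {H} {S} {b} {c} b~c b-obs nbrs-obs a =
  force (b-obs a) (□-adj-fibre {G = G} {H = H} a b~c) (∀-combine {P = OthersObserved} others)
  where
  OthersObserved : Fin _ → Set
  OthersObserved x = adj (G □ H) (combine a b) x ≡ true → x ≢ combine a c → Observed (G □ H) S x

  others : (a′ : Fin m) (b′ : Fin k) → OthersObserved (combine a′ b′)
  others a′ b′ e x≢ac with □-adj⁻ {G = G} {H = H} a b a′ b′ e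
  ... | inj₁ (refl , b~b′) = nbrs-obs b′ b~b′ (λ b′≡c → x≢ac (cong (combine a) b′≡c)) a
  ... | inj₂ (refl , _)    = b-obs a′

apexAndFirst : Subset (2 + k)
apexAndFirst = inside ∷ inside ∷ ⊥

∣apexAndFirst∣ : ∣ apexAndFirst {k} ∣ ≡ 2
∣apexAndFirst∣ {k} = cong (2 +_) (∣⊥∣≡0 k)

apexAndFirst-inducedConnected : InducedConnected (Fan (suc k)) apexAndFirst
apexAndFirst-inducedConnected zero          zero          p _ = here p
apexAndFirst-inducedConnected zero          (suc zero)    p q = step p refl (here q)
apexAndFirst-inducedConnected (suc zero)    zero          p q = step p refl (here q)
apexAndFirst-inducedConnected (suc zero)    (suc zero)    p _ = here p
apexAndFirst-inducedConnected (suc (suc _)) _ (Vec.there (Vec.there p)) _ = ⊥-elim (∉⊥ p)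
apexAndFirst-inducedConnected _ (suc (suc _)) _ (Vec.there (Vec.there q)) = ⊥-elim (∉⊥ q)

Fan-path-adj : (i : Fin k) → adj (Fan (suc k)) (suc (inject₁ i)) (suc (suc i)) ≡ true
Fan-path-adj i rewrite toℕ-inject₁ i | ≡ᵇ-refl (toℕ i) = refl

Fan-path-adj⁻ : (i j : Fin k) → adj (Fan k) (suc i) (suc j) ≡ true →
                toℕ j ≡ suc (toℕ i) ⊎ suc (toℕ j) ≡ toℕ i
Fan-path-adj⁻ i j e with ∨-true⁻ _ _ e
... | inj₁ forward  = inj₁ (sym (≡ᵇ⇒≡ _ _ forward))
... | inj₂ backward = inj₂ (≡ᵇ⇒≡ _ _ backward)

module _ {G : Graph m} {n : ℕ} {S : Subset (m * suc (suc n))} where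

  private
    Layer : Fin (suc (suc n)) → Set
    Layer = LayerObserved G (Fan (suc n)) S

    LayersUpTo : Fin (suc n) → Set
    LayersUpTo i = ∀ j → j Fin.≤ i → Layer (suc j)

  Fan-layersObserved : Layer zero → Layer (suc zero) → ∀ b → Layer b
  Fan-layersObserved apex-obs first-obs zero    = apex-obs
  Fan-layersObserved apex-obs first-obs (suc i) =
    <-weakInduction LayersUpTo upTo-first upTo-next i i ≤-refl
    where
    upTo-first : LayersUpTo zero
    upTo-first zero _ = first-obs

    next : ∀ i → LayersUpTo (inject₁ i) → Layer (suc (suc i))
    next i ih = layer-force {G = G} {H = Fan (suc n)} {S = S}
                  (Fan-path-adj i) (ih (inject₁ i) ≤-refl) earlier
      where
      earlier : ∀ b → adj (Fan (suc n)) (suc (inject₁ i)) b ≡ true → b ≢ suc (suc i) → Layer b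
      earlier zero    _ _ = apex-obs
      earlier (suc j) e b≢next with Fan-path-adj⁻ (inject₁ i) j e
      ... | inj₁ forward  =
        ⊥-elim (b≢next (cong suc (toℕ-injective (trans forward (cong suc (toℕ-inject₁ i))))))
      ... | inj₂ backward = ih j (ℕ.<⇒≤ (≤-reflexive backward))

    upTo-next : ∀ i → LayersUpTo (inject₁ i) → LayersUpTo (suc i)
    upTo-next i ih zero    _ = first-obs
    upTo-next i ih (suc j) (s≤s j≤i) with m≤n⇒m<n∨m≡n j≤i
    ... | inj₁ j<i = ih (suc j) (subst (suc (toℕ j) ℕ.≤_) (sym (toℕ-inject₁ i)) j<i)
    ... | inj₂ j≡i = subst (λ j → Layer (suc (suc j))) (sym (toℕ-injective j≡i)) (next i ih)

corollary5 : (n m : ℕ) → 3 ≤ n → 3 ≤ m → (G : Graph m) → IsSimple G → Connected G →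
    (D : Subset m) → ConnectedDominating G D →
    Σ (Subset (m * suc n)) (λ S → ConnectedPowerDominating (G □ Fan n) S × ∣ S ∣ ≤ 2 * ∣ D ∣)
corollary5 zero    _ () _ _ _ _ _ _
corollary5 (suc n) m _ _ G _ _ D (D-dom , D-conn) =
  S , (powerDominating , connected) , size
  where
  S : Subset (m * suc (suc n))
  S = D ⊠ apexAndFirst

  powerDominating : PowerDominating (G □ Fan (suc n)) S
  powerDominating = ∀-combine λ a b →
    Fan-layersObserved {G = G} {S = S} (observes Vec.here) (observes (Vec.there Vec.here)) b a
    where
    observes : ∀ {b} → b ∈ apexAndFirst → LayerObserved G (Fan (suc n)) S b
    observes = ⊠-observes-layer {H = Fan (suc n)} D-dom

  connected : InducedConnected (G □ Fan (suc n)) S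
  connected = ⊠-inducedConnected D-conn apexAndFirst-inducedConnected

  size : ∣ S ∣ ≤ 2 * ∣ D ∣
  size = ≤-reflexive (begin
    ∣ S ∣                         ≡⟨ ∣⊠∣ D apexAndFirst ⟩
    ∣ D ∣ * ∣ apexAndFirst {n} ∣  ≡⟨ cong (∣ D ∣ *_) (∣apexAndFirst∣ {n}) ⟩
    ∣ D ∣ * 2                     ≡⟨ *-comm ∣ D ∣ 2 ⟩
    2 * ∣ D ∣                     ∎)
    where open ≡-Reasoning
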